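{- Let $\Gamma$ be a distance-regular digraph with vertex set $X$ and diameter $D$. Then for every $x\in X$ the partition $\{\Gamma^{\leftarrow}_0(x),\Gamma^{\leftarrow}_1(x),\ldots,\Gamma^{\leftarrow}_D(x)\}$ of $X$ is equitable, and moreover $$\{\Gamma^{\rightarrow}_0(x),\ldots,\Gamma^{\rightarrow}_D(x)\}=\{\Gamma^{\leftarrow}_0(x),\ldots,\Gamma^{\leftarrow}_D(x)\}$$ as sets of subsets of $X$.
   Context: Digraphs are simple and strongly connected. $\partial(x,y)$ is the directed distance; $\Gamma^{\rightarrow}_i(x)=\{z\mid\partial(x,z)=i\}$, $\Gamma^{\leftarrow}_i(x)=\{z\mid\partial(z,x)=i\}$. A partition $\{P_0,\ldots,P_s\}$ of $X$ is equitable if for all $i,j$ the numbers $|\Gamma^{\rightarrow}_1(y)\cap P_j|$ and $|\Gamma^{\leftarrow}_1(y)\cap P_j|$ do not depend on the choice of $y\in P_i$. $\Gamma$ is a distance-regular digraph if there are integers $d^{\rightarrow}_{ij},d^{\leftarrow}_{ij}$ $(0\le i,j\le D)$ such that for every $x\in X$ and every $y\in\Gamma^{\rightarrow}_i(x)$: $|\Gamma^{\rightarrow}_1(y)\cap\Gamma^{\rightarrow}_j(x)|=d^{\rightarrow}_{ij}$ and $|\Gamma^{\leftarrow}_1(y)\cap\Gamma^{\rightarrow}_j(x)|=d^{\leftarrow}_{ij}$. -}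

module Defs where

open import Data.Nat using (ℕ; zero; suc; _≤_; _≡ᵇ_)
open import Data.Fin using (Fin; zero; suc)
open import Data.Fin.Properties using (_≟_)
open import Data.Bool using (Bool; true; false; _∧_; _∨_; if_then_else_)
open import Data.Product using (Σ; _×_; ∃-syntax)
open import Relation.Nullary.Decidable using (⌊_⌋)
open import Relation.Binary.PropositionalEquality using (_≡_)

-- A digraph on the vertex set X = Fin n, given by its arc relation:
-- A x y ≡ true  iff  there is an arc x → y.
Adj : ℕ → Set
Adj n = Fin n → Fin n → Bool

-- simple: no loops (multiple arcs are impossible in this encoding)
Loopless : ∀ {n} → Adj n → Set
Loopless A = ∀ x → A x x ≡ false

anyFin : ∀ {n} → (Fin n → Bool) → Bool
anyFin {zero}  f = false
anyFin {suc n} f = f zero ∨ anyFin (λ i → f (suc i))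

count : ∀ {n} → (Fin n → Bool) → ℕ
count {zero}  f = 0
count {suc n} f = if f zero then suc (count (λ i → f (suc i))) else count (λ i → f (suc i))

reach : ∀ {n} → Adj n → Fin n → Fin n → ℕ → Bool
reach A x y zero    = ⌊ x ≟ y ⌋
reach A x y (suc k) = anyFin (λ z → A x z ∧ reach A z y k)

-- least i in [start, start+fuel) with p i, and start+fuel if none
firstFrom : (ℕ → Bool) → ℕ → ℕ → ℕ
firstFrom p i zero       = i
firstFrom p i (suc fuel) = if p i then i else firstFrom p (suc i) fuel

-- A shortest walk has length < n, so searching 0..n-1 suffices;
-- the value n is returned when y is unreachable (never happens in a
-- strongly connected digraph).
dist : ∀ {n} → Adj n → Fin n → Fin n → ℕ
dist {n} A x y = firstFrom (reach A x y) 0 n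

StronglyConnected : ∀ {n} → Adj n → Set
StronglyConnected A = ∀ x y → ∃[ k ] reach A x y k ≡ true

IsDiameter : ∀ {n} → Adj n → ℕ → Set
IsDiameter A D = (∀ x y → dist A x y ≤ D) × (∃[ x ] ∃[ y ] dist A x y ≡ D)

OutLayer : ∀ {n} → Adj n → Fin n → ℕ → Fin n → Bool
OutLayer A x i z = dist A x z ≡ᵇ i

InLayer : ∀ {n} → Adj n → Fin n → ℕ → Fin n → Bool
InLayer A x i z = dist A z x ≡ᵇ i

outCount : ∀ {n} → Adj n → Fin n → (Fin n → Bool) → ℕ
outCount A y S = count (λ z → A y z ∧ S z)

inCount : ∀ {n} → Adj n → Fin n → (Fin n → Bool) → ℕ
inCount A y S = count (λ z → A z y ∧ S z)

DistanceRegular : ∀ {n} → Adj n → ℕ → Set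
DistanceRegular A D =
  Σ (ℕ → ℕ → ℕ) λ dout → Σ (ℕ → ℕ → ℕ) λ din →
    (∀ x y i j → i ≤ D → j ≤ D → dist A x y ≡ i →
       (outCount A y (OutLayer A x j) ≡ dout i j)
       × (inCount A y (OutLayer A x j) ≡ din i j))

IsPartition : ∀ {n} → ℕ → (ℕ → Fin n → Bool) → Set
IsPartition s P =
  (∀ z → ∃[ i ] (i ≤ s × P i z ≡ true × (∀ j → j ≤ s → P j z ≡ true → j ≡ i)))
  × (∀ i → i ≤ s → ∃[ z ] P i z ≡ true)

Equitable : ∀ {n} → Adj n → ℕ → (ℕ → Fin n → Bool) → Set
Equitable A s P =
  ∀ i j → i ≤ s → j ≤ s → ∀ y y' → P i y ≡ true → P i y' ≡ true →
    (outCount A y (P j) ≡ outCount A y' (P j))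
    × (inCount A y (P j) ≡ inCount A y' (P j))

SameFamily : ∀ {n} → ℕ → (ℕ → Fin n → Bool) → (ℕ → Fin n → Bool) → Set
SameFamily s P Q =
  (∀ i → i ≤ s → ∃[ j ] (j ≤ s × (∀ z → P i z ≡ Q j z)))
  × (∀ j → j ≤ s → ∃[ i ] (i ≤ s × (∀ z → P i z ≡ Q j z)))

{-# OPTIONS --safe #-}
module Submission where

-- Whether y can walk back to x in at most t steps depends only on ∂(x,y): for t > 0 it holds
-- iff y = x or y has an out-neighbour in some Γ→_j(x) from which x is reachable in t − 1
-- steps, and y has an out-neighbour in Γ→_j(x) iff d→_{∂(x,y),j} > 0.  Hence ∂(y,x) is a
-- function of ∂(x,y), so every Γ→_i(x) is some Γ←_j(x) and conversely, and the in-layers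
-- inherit equitability from the intersection numbers of the out-layers.  All layers are
-- nonempty because d→_{i,i+1} > 0, as witnessed on a geodesic of length D.

open import Defs
open import Data.Nat using (ℕ)
open import Data.Fin using (Fin)
open import Data.Product using (_×_)

open import Data.Bool using (Bool; true; false; _∧_; T)
open import Data.Bool.Properties using (T-≡)
open import Data.Fin using (zero; suc; toℕ)
import Data.Fin.Properties as Fin
open import Data.Nat using (zero; suc; _+_; _∸_; _≤_; _<_; z≤n; s≤s; z<s; _≡ᵇ_; _≤?_)
open import Data.Nat.Properties
open import Data.Nat.Induction using (<-rec)
open import Data.Product using (_,_; proj₁; proj₂; ∃-syntax; ∃₂)
open import Data.Sum using (_⊎_; inj₁; inj₂)
open import Function using (_∘_; _⇔_; mk⇔; Equivalence)
open import Relation.Nullary using (yes; no; contradiction)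
open import Relation.Nullary.Decidable using (toWitness; fromWitness)
open import Relation.Binary.PropositionalEquality
open ≡-Reasoning

open Equivalence using (to; from)

T⇒≡true : ∀ {b} → T b → b ≡ true
T⇒≡true = to T-≡

∧-true⁻ : ∀ {a b} → a ∧ b ≡ true → a ≡ true × b ≡ true
∧-true⁻ {true} {true} _ = refl , refl

∧-true⁺ : ∀ {a b} → a ≡ true → b ≡ true → a ∧ b ≡ true
∧-true⁺ refl refl = refl

≡true-ext : ∀ {a b} → (a ≡ true → b ≡ true) → (b ≡ true → a ≡ true) → a ≡ b
≡true-ext {true}  {true}  _ _ = refl
≡true-ext {true}  {false} f _ = sym (f refl)
≡true-ext {false} {true}  _ g = g refl
≡true-ext {false} {false} _ _ = refl

≡ᵇ-true⇒≡ : ∀ {m n} → (m ≡ᵇ n) ≡ true → m ≡ n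
≡ᵇ-true⇒≡ {m} {n} e = ≡ᵇ⇒≡ m n (from T-≡ e)

≡⇒≡ᵇ-true : ∀ {m n} → m ≡ n → (m ≡ᵇ n) ≡ true
≡⇒≡ᵇ-true {m} {n} e = T⇒≡true (≡⇒≡ᵇ m n e)

anyFin⇒∃ : ∀ {n} (f : Fin n → Bool) → anyFin f ≡ true → ∃[ z ] f z ≡ true
anyFin⇒∃ {zero}  f ()
anyFin⇒∃ {suc n} f any with f zero in f₀
... | true  = zero , f₀
... | false = let z , fz = anyFin⇒∃ (f ∘ suc) any in suc z , fz

∃⇒anyFin : ∀ {n} (f : Fin n → Bool) z → f z ≡ true → anyFin f ≡ true
∃⇒anyFin f zero    fz rewrite fz = refl
∃⇒anyFin f (suc z) fz with f zero
... | true  = refl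
... | false = ∃⇒anyFin (f ∘ suc) z fz

0<count⇒∃ : ∀ {n} (f : Fin n → Bool) → 0 < count f → ∃[ z ] f z ≡ true
0<count⇒∃ {zero}  f ()
0<count⇒∃ {suc n} f pos with f zero in f₀
... | true  = zero , f₀
... | false = let z , fz = 0<count⇒∃ (f ∘ suc) pos in suc z , fz

∃⇒0<count : ∀ {n} (f : Fin n → Bool) z → f z ≡ true → 0 < count f
∃⇒0<count f zero    fz rewrite fz = z<s
∃⇒0<count f (suc z) fz with f zero
... | true  = z<s
... | false = ∃⇒0<count (f ∘ suc) z fz

count-cong : ∀ {n} {f g : Fin n → Bool} → (∀ z → f z ≡ g z) → count f ≡ count g
count-cong {zero}          _   = refl
count-cong {suc n} {f} {g} f≗g rewrite f≗g zero with g zero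
... | true  = cong suc (count-cong (f≗g ∘ suc))
... | false = count-cong (f≗g ∘ suc)

firstFrom-≤ : ∀ p {i k} fuel → p k ≡ true → i ≤ k → firstFrom p i fuel ≤ k
firstFrom-≤ p zero pk i≤k = i≤k
firstFrom-≤ p {i} (suc fuel) pk i≤k with p i in pᵢ
... | true  = i≤k
... | false with m≤n⇒m<n∨m≡n i≤k
...   | inj₁ i<k  = firstFrom-≤ p fuel pk i<k
...   | inj₂ refl = contradiction (trans (sym pᵢ) pk) λ ()

firstFrom-true : ∀ p i fuel → firstFrom p i fuel < i + fuel → p (firstFrom p i fuel) ≡ true
firstFrom-true p i zero lt rewrite +-identityʳ i = contradiction lt (<-irrefl refl)
firstFrom-true p i (suc fuel) lt with p i in pᵢ
... | true  = pᵢ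
... | false = firstFrom-true p (suc i) fuel (subst (firstFrom p (suc i) fuel <_) (+-suc i fuel) lt)

module Walks {n : ℕ} (A : Adj n) where

  reach-zero⁻ : ∀ {a b} → reach A a b 0 ≡ true → a ≡ b
  reach-zero⁻ ab = toWitness (from T-≡ ab)

  reach-refl : ∀ a → reach A a a 0 ≡ true
  reach-refl a = T⇒≡true (fromWitness refl)

  reach-suc⁻ : ∀ {a b} k → reach A a b (suc k) ≡ true →
               ∃[ z ] (A a z ≡ true × reach A z b k ≡ true)
  reach-suc⁻ {a} {b} k ab =
    let z , azb = anyFin⇒∃ (λ z → A a z ∧ reach A z b k) ab in z , ∧-true⁻ azb

  reach-suc⁺ : ∀ {a z b} k → A a z ≡ true → reach A z b k ≡ true → reach A a b (suc k) ≡ true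
  reach-suc⁺ {z = z} _ az zb = ∃⇒anyFin _ z (∧-true⁺ az zb)

  reach-+ : ∀ {a b c} p {q} → reach A a b p ≡ true → reach A b c q ≡ true →
            reach A a c (p + q) ≡ true
  reach-+ zero    ab bc rewrite reach-zero⁻ ab = bc
  reach-+ (suc p) ab bc =
    let z , az , zb = reach-suc⁻ p ab in reach-suc⁺ (p + _) az (reach-+ p zb bc)

  reach-split : ∀ {a c} p q → reach A a c (p + q) ≡ true →
                ∃[ b ] (reach A a b p ≡ true × reach A b c q ≡ true)
  reach-split zero    q ac = _ , reach-refl _ , ac
  reach-split (suc p) q ac =
    let z , az , zc = reach-suc⁻ (p + q) ac
        b , zb , bc = reach-split p q zc
    in b , reach-suc⁺ p az zb , bc

  -- Two of the first n + 1 vertices of a long walk coincide; drop the closed walk between them.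
  reach-cutCycle : ∀ {a b k} → n ≤ k → reach A a b k ≡ true →
                   ∃[ m ] (m < k × reach A a b m ≡ true)
  reach-cutCycle {a} {b} {k} n≤k ab = cut (Fin.pigeonhole (n<1+n n) (proj₁ ∘ waypoint))
    where
    toℕ≤k : (j : Fin (suc n)) → toℕ j ≤ k
    toℕ≤k j = ≤-trans (Fin.toℕ≤pred[n] j) n≤k

    waypoint : (j : Fin (suc n)) →
               ∃[ w ] (reach A a w (toℕ j) ≡ true × reach A w b (k ∸ toℕ j) ≡ true)
    waypoint j = reach-split (toℕ j) (k ∸ toℕ j)
      (subst (λ l → reach A a b l ≡ true) (sym (m+[n∸m]≡n (toℕ≤k j))) ab)

    cut : ∃₂ (λ i j → toℕ i < toℕ j × proj₁ (waypoint i) ≡ proj₁ (waypoint j)) →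
          ∃[ m ] (m < k × reach A a b m ≡ true)
    cut (i , j , i<j , wᵢ≡wⱼ) =
      toℕ i + (k ∸ toℕ j) ,
      subst (toℕ i + (k ∸ toℕ j) <_) (m+[n∸m]≡n (toℕ≤k j)) (+-monoˡ-< (k ∸ toℕ j) i<j) ,
      reach-+ (toℕ i) (proj₁ (proj₂ (waypoint i)))
        (subst (λ w → reach A w b (k ∸ toℕ j) ≡ true) (sym wᵢ≡wⱼ)
               (proj₂ (proj₂ (waypoint j))))

  reach-shorten : ∀ {a b} k → reach A a b k ≡ true → ∃[ m ] (m < n × reach A a b m ≡ true)
  reach-shorten {a} {b} = <-rec ShortWalkFrom shorten
    where
    ShortWalkFrom : ℕ → Set
    ShortWalkFrom k = reach A a b k ≡ true → ∃[ m ] (m < n × reach A a b m ≡ true)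

    shorten : ∀ k → (∀ {m} → m < k → ShortWalkFrom m) → ShortWalkFrom k
    shorten k shorter ab with n ≤? k
    ... | no  n≰k = k , ≰⇒> n≰k , ab
    ... | yes n≤k = let m , m<k , ab′ = reach-cutCycle n≤k ab in shorter m<k ab′

  dist-≤ : ∀ {a b} k → reach A a b k ≡ true → dist A a b ≤ k
  dist-≤ k ab = firstFrom-≤ _ n ab z≤n

  ReachWithin : Fin n → Fin n → ℕ → Set
  ReachWithin a b t = ∃[ k ] (k ≤ t × reach A a b k ≡ true)

  reachWithin-refl : ∀ a {t} → ReachWithin a a t
  reachWithin-refl a = 0 , z≤n , reach-refl a

  reachWithin-zero⁻ : ∀ {a b} → ReachWithin a b 0 → a ≡ b
  reachWithin-zero⁻ (zero , _ , ab) = reach-zero⁻ ab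

  reachWithin-suc⁻ : ∀ {a b t} → ReachWithin a b (suc t) →
                     a ≡ b ⊎ ∃[ z ] (A a z ≡ true × ReachWithin z b t)
  reachWithin-suc⁻ (zero  , _       , ab) = inj₁ (reach-zero⁻ ab)
  reachWithin-suc⁻ (suc k , s≤s k≤t , ab) =
    let z , az , zb = reach-suc⁻ k ab in inj₂ (z , az , k , k≤t , zb)

  reachWithin-suc⁺ : ∀ {a b t} → a ≡ b ⊎ ∃[ z ] (A a z ≡ true × ReachWithin z b t) →
                     ReachWithin a b (suc t)
  reachWithin-suc⁺ (inj₁ refl)                    = reachWithin-refl _
  reachWithin-suc⁺ (inj₂ (z , az , k , k≤t , zb)) = suc k , s≤s k≤t , reach-suc⁺ k az zb

module StronglyConnectedDigraph {n : ℕ} (A : Adj n) (strong : StronglyConnected A) where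
  open Walks A

  dist<n : ∀ a b → dist A a b < n
  dist<n a b =
    let k , ab      = strong a b
        m , m<n , ab′ = reach-shorten k ab
    in ≤-<-trans (dist-≤ m ab′) m<n

  reach-dist : ∀ a b → reach A a b (dist A a b) ≡ true
  reach-dist a b = firstFrom-true (reach A a b) 0 n (dist<n a b)

  dist≤⇔reachWithin : ∀ {a b t} → dist A a b ≤ t ⇔ ReachWithin a b t
  dist≤⇔reachWithin {a} {b} = mk⇔
    (λ d≤t → dist A a b , d≤t , reach-dist a b)
    (λ (k , k≤t , ab) → ≤-trans (dist-≤ k ab) k≤t)

  dist-refl : ∀ a → dist A a a ≡ 0
  dist-refl a = n≤0⇒n≡0 (dist-≤ 0 (reach-refl a))

  dist≡0⇒≡ : ∀ {a b} → dist A a b ≡ 0 → a ≡ b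
  dist≡0⇒≡ {a} {b} ab = reach-zero⁻ (subst (λ l → reach A a b l ≡ true) ab (reach-dist a b))

  dist≡1⇒arc : ∀ {a b} → dist A a b ≡ 1 → A a b ≡ true
  dist≡1⇒arc {a} {b} ab =
    let z , az , zb = reach-suc⁻ 0 (subst (λ l → reach A a b l ≡ true) ab (reach-dist a b))
    in subst (λ v → A a v ≡ true) (reach-zero⁻ zb) az

  dist-triangle : ∀ a b c → dist A a c ≤ dist A a b + dist A b c
  dist-triangle a b c = dist-≤ _ (reach-+ (dist A a b) (reach-dist a b) (reach-dist b c))

  dist-split : ∀ {a c} p q → dist A a c ≡ p + q → ∃[ b ] (dist A a b ≡ p × dist A b c ≡ q)
  dist-split {a} {c} p q ac
    with reach-split p q (subst (λ l → reach A a c l ≡ true) ac (reach-dist a c))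
  ... | b , ab , bc = b , ≤-antisym ab≤p p≤ab , ≤-antisym bc≤q q≤bc
    where
    ab≤p : dist A a b ≤ p
    ab≤p = dist-≤ p ab
    bc≤q : dist A b c ≤ q
    bc≤q = dist-≤ q bc
    p+q≤ : p + q ≤ dist A a b + dist A b c
    p+q≤ = subst (_≤ dist A a b + dist A b c) ac (dist-triangle a b c)
    p≤ab : p ≤ dist A a b
    p≤ab = +-cancelʳ-≤ q p (dist A a b) (≤-trans p+q≤ (+-monoʳ-≤ (dist A a b) bc≤q))
    q≤bc : q ≤ dist A b c
    q≤bc = +-cancelˡ-≤ p q (dist A b c) (≤-trans p+q≤ (+-monoˡ-≤ (dist A b c) ab≤p))

module DistanceRegularDigraph {n : ℕ} (A : Adj n) (D : ℕ) (strong : StronglyConnected A)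
                              (diameter : IsDiameter A D) (regular : DistanceRegular A D) where
  open Walks A
  open StronglyConnectedDigraph A strong

  dist≤D : ∀ a b → dist A a b ≤ D
  dist≤D = proj₁ diameter

  dout din : ℕ → ℕ → ℕ
  dout = proj₁ regular
  din  = proj₁ (proj₂ regular)

  outCount-OutLayer : ∀ x y {j} → j ≤ D → outCount A y (OutLayer A x j) ≡ dout (dist A x y) j
  outCount-OutLayer x y j≤D = proj₁ (proj₂ (proj₂ regular) x y _ _ (dist≤D x y) j≤D refl)

  inCount-OutLayer : ∀ x y {j} → j ≤ D → inCount A y (OutLayer A x j) ≡ din (dist A x y) j
  inCount-OutLayer x y j≤D = proj₂ (proj₂ (proj₂ regular) x y _ _ (dist≤D x y) j≤D refl)

  arcIntoOutLayer⇔0<dout : ∀ x y {j} → j ≤ D →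
                           (∃[ z ] (A y z ≡ true × dist A x z ≡ j)) ⇔ 0 < dout (dist A x y) j
  arcIntoOutLayer⇔0<dout x y j≤D = mk⇔
    (λ (z , yz , xz) → subst (0 <_) (outCount-OutLayer x y j≤D)
                         (∃⇒0<count _ z (∧-true⁺ yz (≡⇒≡ᵇ-true xz))))
    (λ pos → let z , yz∧xz = 0<count⇒∃ _ (subst (0 <_) (sym (outCount-OutLayer x y j≤D)) pos)
                 yz , xz   = ∧-true⁻ yz∧xz
             in z , yz , ≡ᵇ-true⇒≡ xz)

  ReturnsWithin : ℕ → ℕ → Set
  ReturnsWithin zero    i = i ≡ 0
  ReturnsWithin (suc t) i = i ≡ 0 ⊎ ∃[ j ] (j ≤ D × 0 < dout i j × ReturnsWithin t j)

  reachWithin⇔ReturnsWithin : ∀ t x y → ReachWithin y x t ⇔ ReturnsWithin t (dist A x y)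
  reachWithin⇔ReturnsWithin zero x y = mk⇔
    (λ yx → subst (λ v → dist A x v ≡ 0) (sym (reachWithin-zero⁻ yx)) (dist-refl x))
    (λ xy → subst (λ v → ReachWithin v x 0) (dist≡0⇒≡ xy) (reachWithin-refl x))
  reachWithin⇔ReturnsWithin (suc t) x y = mk⇔ returns reaches
    where
    returns : ReachWithin y x (suc t) → ReturnsWithin (suc t) (dist A x y)
    returns yx with reachWithin-suc⁻ yx
    ... | inj₁ refl           = inj₁ (dist-refl y)
    ... | inj₂ (z , yz , zx) =
      inj₂ (dist A x z , dist≤D x z , to (arcIntoOutLayer⇔0<dout x y (dist≤D x z)) (z , yz , refl)
           , to (reachWithin⇔ReturnsWithin t x z) zx)

    reaches : ReturnsWithin (suc t) (dist A x y) → ReachWithin y x (suc t)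
    reaches (inj₁ xy)                  = reachWithin-suc⁺ (inj₁ (sym (dist≡0⇒≡ xy)))
    reaches (inj₂ (j , j≤D , pos , z↩)) =
      let z , yz , xz = from (arcIntoOutLayer⇔0<dout x y j≤D) pos
      in reachWithin-suc⁺ (inj₂ (z , yz , from (reachWithin⇔ReturnsWithin t x z)
                                             (subst (ReturnsWithin t) (sym xz) z↩)))

  dist-converse-cong : ∀ {x y x′ y′} → dist A x y ≡ dist A x′ y′ → dist A y x ≡ dist A y′ x′
  dist-converse-cong eq = ≤-antisym (dist-converse-≤ eq) (dist-converse-≤ (sym eq))
    where
    dist-converse-≤ : ∀ {x y x′ y′} → dist A x y ≡ dist A x′ y′ → dist A y x ≤ dist A y′ x′
    dist-converse-≤ {x} {y} {x′} {y′} eq =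
      from dist≤⇔reachWithin (from (reachWithin⇔ReturnsWithin _ x y)
        (subst (ReturnsWithin _) (sym eq)
          (to (reachWithin⇔ReturnsWithin _ x′ y′) (to dist≤⇔reachWithin ≤-refl))))

  OutLayer≡InLayer : ∀ x y z → OutLayer A x (dist A x y) z ≡ InLayer A x (dist A y x) z
  OutLayer≡InLayer x y z = ≡true-ext
    (λ xz → ≡⇒≡ᵇ-true (dist-converse-cong (≡ᵇ-true⇒≡ xz)))
    (λ zx → ≡⇒≡ᵇ-true (dist-converse-cong (≡ᵇ-true⇒≡ zx)))

  dist-attained : ∀ {i} → i ≤ D → ∃[ a ] ∃[ b ] dist A a b ≡ i
  dist-attained {i} i≤D =
    let x , y , xy≡D = proj₂ diameter
        w , _ , wy   = dist-split (D ∸ i) i (trans xy≡D (sym (m∸n+n≡m i≤D)))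
    in w , y , wy

  0<dout[i,1+i] : ∀ {i} → suc i ≤ D → 0 < dout i (suc i)
  0<dout[i,1+i] {i} i<D =
    let a , b , ab  = dist-attained i<D
        w , aw , wb = dist-split i 1 (trans ab (+-comm 1 i))
    in subst (λ d → 0 < dout d (suc i)) aw
         (to (arcIntoOutLayer⇔0<dout a w i<D) (b , dist≡1⇒arc wb , ab))

  outLayer-nonempty : ∀ x {i} → i ≤ D → ∃[ y ] dist A x y ≡ i
  outLayer-nonempty x {zero}  _   = x , dist-refl x
  outLayer-nonempty x {suc i} i<D =
    let y , xy     = outLayer-nonempty x (<⇒≤ i<D)
        z , _ , xz = from (arcIntoOutLayer⇔0<dout x y i<D)
                       (subst (λ d → 0 < dout d (suc i)) (sym xy) (0<dout[i,1+i] i<D))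
    in z , xz

  inLayer-nonempty : ∀ x {j} → j ≤ D → ∃[ z ] dist A z x ≡ j
  inLayer-nonempty x j≤D =
    let y , xy = outLayer-nonempty x j≤D
        z , xz = outLayer-nonempty x (dist≤D y x)
    in z , trans (dist-converse-cong xz) xy

  sameFamily : ∀ x → SameFamily D (OutLayer A x) (InLayer A x)
  sameFamily x = outLayer-isInLayer , inLayer-isOutLayer
    where
    outLayer-isInLayer : ∀ i → i ≤ D → ∃[ j ] (j ≤ D × (∀ z → OutLayer A x i z ≡ InLayer A x j z))
    outLayer-isInLayer i i≤D with outLayer-nonempty x i≤D
    ... | y , refl = dist A y x , dist≤D y x , OutLayer≡InLayer x y

    inLayer-isOutLayer : ∀ j → j ≤ D → ∃[ i ] (i ≤ D × (∀ z → OutLayer A x i z ≡ InLayer A x j z))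
    inLayer-isOutLayer j j≤D with inLayer-nonempty x j≤D
    ... | z , refl = dist A x z , dist≤D x z , OutLayer≡InLayer x z

  inLayers-partition : ∀ x → IsPartition D (InLayer A x)
  inLayers-partition x =
      (λ z → dist A z x , dist≤D z x , ≡⇒≡ᵇ-true {dist A z x} refl , λ _ _ zx → sym (≡ᵇ-true⇒≡ zx))
    , (λ i i≤D → let z , zx = inLayer-nonempty x i≤D in z , ≡⇒≡ᵇ-true zx)

  inLayers-equitable : ∀ x → Equitable A D (InLayer A x)
  inLayers-equitable x i j _ j≤D y y′ yx y′x with proj₂ (sameFamily x) j j≤D
  ... | j′ , j′≤D , sameLayer = out , in′
    where
    xy≡xy′ : dist A x y ≡ dist A x y′
    xy≡xy′ = dist-converse-cong (trans (≡ᵇ-true⇒≡ yx) (sym (≡ᵇ-true⇒≡ y′x)))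

    outCount-InLayer : ∀ v → outCount A v (InLayer A x j) ≡ dout (dist A x v) j′
    outCount-InLayer v =
      trans (count-cong λ z → cong (A v z ∧_) (sym (sameLayer z))) (outCount-OutLayer x v j′≤D)

    inCount-InLayer : ∀ v → inCount A v (InLayer A x j) ≡ din (dist A x v) j′
    inCount-InLayer v =
      trans (count-cong λ z → cong (A z v ∧_) (sym (sameLayer z))) (inCount-OutLayer x v j′≤D)

    out : outCount A y (InLayer A x j) ≡ outCount A y′ (InLayer A x j)
    out = begin
      outCount A y (InLayer A x j)  ≡⟨ outCount-InLayer y ⟩
      dout (dist A x y) j′          ≡⟨ cong (λ d → dout d j′) xy≡xy′ ⟩
      dout (dist A x y′) j′         ≡⟨ outCount-InLayer y′ ⟨
      outCount A y′ (InLayer A x j) ∎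

    in′ : inCount A y (InLayer A x j) ≡ inCount A y′ (InLayer A x j)
    in′ = begin
      inCount A y (InLayer A x j)  ≡⟨ inCount-InLayer y ⟩
      din (dist A x y) j′          ≡⟨ cong (λ d → din d j′) xy≡xy′ ⟩
      din (dist A x y′) j′         ≡⟨ inCount-InLayer y′ ⟨
      inCount A y′ (InLayer A x j) ∎

proposition4p6 : ∀ {n} (A : Adj n) (D : ℕ) →
    Loopless A → StronglyConnected A → IsDiameter A D → DistanceRegular A D →
    ∀ (x : Fin n) →
      (IsPartition D (InLayer A x) × Equitable A D (InLayer A x))
      × SameFamily D (OutLayer A x) (InLayer A x)
proposition4p6 A D _ strong diameter regular x =
  (inLayers-partition x , inLayers-equitable x) , sameFamily x
  where open DistanceRegularDigraph A D strong diameter regular
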